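{- Let $\varepsilon\colon X^{\times}_{\mathrm{irr}}\to\mathcal{P}(M)$ be a Fitch map explained by the edge-labeled tree $(T,\lambda)$, and let $P=\{M_1,\dots,M_k\}$, $k\ge1$, be a partition of $M$. Then the $P$-recolored map $\varepsilon_P$, $\varepsilon_P(x,y)=\{i\in\{1,\dots,k\}:\varepsilon(x,y)\cap M_i\neq\emptyset\}$, is a Fitch map that is explained by $(T,\lambda_P)$, where $\lambda_P(e)=\{i\in\{1,\dots,k\}:\lambda(e)\cap M_i\neq\emptyset\}$.
   Context: $X$ is a finite nonempty set, $M$ a finite nonempty set of colors, $X^{\times}_{\mathrm{irr}}=\{(x,y)\in X\times X: x\neq y\}$. A phylogenetic tree on $X$ is a rooted tree whose leaves (non-root vertices of degree $1$) form $X$, whose root has degree $\ge2$ and whose non-root inner vertices have degree $\ge3$; $\mathrm{lca}(x,y)$ is the last common ancestor. An edge-labeled tree $(T,\lambda)$ on $X$ with a color set $C$ is a phylogenetic tree $T$ on $X$ with $\lambda\colon E(T)\to\mathcal{P}(C)$; $e$ is a $c$-edge if $c\in\lambda(e)$. $(T,\lambda)$ explains a map $\varepsilon\colon X^{\times}_{\mathrm{irr}}\to\mathcal{P}(C)$ if for all $(x,y)\in X^{\times}_{\mathrm{irr}}$, $c\in C$: $c\in\varepsilon(x,y)$ iff the path from $\mathrm{lca}(x,y)$ to $y$ contains a $c$-edge; $\varepsilon$ is a Fitch map if some edge-labeled tree explains it. -}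

module Defs where

open import Data.Nat using (ℕ; zero; suc)
open import Data.Fin using (Fin; _≟_)
open import Data.Fin.Subset using (Subset; _∈_)
open import Data.Fin.Subset.Properties using (_∈?_)
open import Data.Fin.Properties using (any?)
open import Data.Vec using (tabulate)
open import Data.Product using (Σ; ∃; _×_; _,_)
open import Relation.Nullary using (¬_; does)
open import Relation.Nullary.Decidable using (_×-dec_)
open import Relation.Binary.PropositionalEquality using (_≡_; _≢_)
open import Function.Definitions using (Injective)

iter : {A : Set} → (A → A) → ℕ → A → A
iter f zero    a = a
iter f (suc j) a = f (iter f j a)

-- The edges are the pairs (parent v , v) for v ≢ root (so edges ≅ non-root vertices).
record PhyloTree (n : ℕ) : Set where
  field
    N      : ℕ
    root   : Fin N
    parent : Fin N → Fin N
    parent-root : parent root ≡ root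
    reaches-root : ∀ v → ∃ λ j → iter parent j v ≡ root

  _⪯_ : Fin N → Fin N → Set
  u ⪯ v = ∃ λ j → iter parent j v ≡ u

  IsChild : Fin N → Fin N → Set
  IsChild c u = c ≢ root × parent c ≡ u

  IsLeaf : Fin N → Set
  IsLeaf u = u ≢ root × (∀ c → ¬ IsChild c u)

  TwoChildren : Fin N → Set
  TwoChildren u = Σ (Fin N) λ a → Σ (Fin N) λ b → a ≢ b × IsChild a u × IsChild b u

  field
    root-deg : TwoChildren root
    -- non-root inner vertices (non-root, non-leaf) have degree ≥ 3,
    -- i.e. (one parent edge and) at least two children
    inner-deg : ∀ u → u ≢ root → ¬ IsLeaf u → TwoChildren u
    leaf     : Fin n → Fin N
    leaf-inj : Injective _≡_ _≡_ leaf
    leaf-isLeaf : ∀ x → IsLeaf (leaf x)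
    leaf-onto   : ∀ u → IsLeaf u → ∃ λ x → leaf x ≡ u

  IsLCA : Fin N → Fin n → Fin n → Set
  IsLCA u x y = u ⪯ leaf x × u ⪯ leaf y
              × (∀ w → w ⪯ leaf x → w ⪯ leaf y → w ⪯ u)

open PhyloTree public

-- an edge labeling with colors Fin m: each edge (parent v , v), v ≢ root, gets a subset
Labeling : {n : ℕ} → PhyloTree n → ℕ → Set
Labeling T m = (v : Fin (N T)) → v ≢ root T → Subset m

IrrMap : ℕ → ℕ → Set
IrrMap n m = (x y : Fin n) → x ≢ y → Subset m

-- the path from u to the vertex v contains a c-edge: some edge (parent w , w)
-- with u a strict ancestor of w and w an ancestor-or-self of v carries c
PathHasColor : {n m : ℕ} (T : PhyloTree n) → Labeling T m →
               Fin (N T) → Fin (N T) → Fin m → Set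
PathHasColor T lab u v c =
  Σ (Fin (N T)) λ w → Σ (w ≢ root T) λ h →
    (c ∈ lab w h) × _⪯_ T w v × _⪯_ T u w × u ≢ w

Explains : {n m : ℕ} (T : PhyloTree n) → Labeling T m → IrrMap n m → Set
Explains {n} {m} T lab ε =
  ∀ (x y : Fin n) (x≢y : x ≢ y) (c : Fin m) (u : Fin (N T)) → IsLCA T u x y →
    ((c ∈ ε x y x≢y → PathHasColor T lab u (leaf T y) c)
     × (PathHasColor T lab u (leaf T y) c → c ∈ ε x y x≢y))

IsFitch : {n m : ℕ} → IrrMap n m → Set
IsFitch {n} {m} ε = Σ (PhyloTree n) λ T → Σ (Labeling T m) λ lab → Explains T lab ε

-- A partition P = {M_1,…,M_k} of Fin m is given by the block-index map
-- p : Fin m → Fin k (M_i = p⁻¹(i)); blocks are nonempty iff p is surjective.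
-- recolor p S = { i : S ∩ M_i ≠ ∅ }
recolor : {m k : ℕ} → (Fin m → Fin k) → Subset m → Subset k
recolor p S = tabulate λ i → does (any? λ c → (c ∈? S) ×-dec (p c ≟ i))

recolorMap : {n m k : ℕ} → (Fin m → Fin k) → IrrMap n m → IrrMap n k
recolorMap p ε x y h = recolor p (ε x y h)

recolorLab : {n m k : ℕ} {T : PhyloTree n} → (Fin m → Fin k) → Labeling T m → Labeling T k
recolorLab p lab v h = recolor p (lab v h)

-- Recoloring commutes with "some edge on the path carries the color": both sides
-- say that some original color in the block of i occurs on the path.
module Submission where

open import Defs
open import Data.Nat using (ℕ; _≤_)
open import Data.Fin using (Fin; _≟_)
open import Data.Fin.Subset using (Subset; _∈_)
open import Data.Fin.Subset.Properties using (_∈?_)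
open import Data.Fin.Properties using (any?)
open import Data.Vec using (tabulate)
open import Data.Vec.Properties using ([]=⇒lookup; lookup⇒[]=; lookup∘tabulate)
open import Data.Product using (_×_; _,_; ∃)
open import Function.Bundles using (_⇔_; mk⇔; Equivalence)
open import Function.Definitions using (Surjective)
import Function.Properties.Equivalence as ⇔
open import Level using (0ℓ)
open import Relation.Nullary using (yes; no; does)
open import Relation.Nullary.Decidable using (dec-true; _×-dec_)
open import Relation.Unary using (Pred; Decidable)
open import Relation.Binary.PropositionalEquality using (_≡_; sym; trans)

open Equivalence using (to; from)

∈-tabulate-does⇔ : {k : ℕ} {P : Pred (Fin k) 0ℓ} (P? : Decidable P) (i : Fin k) →
                   i ∈ tabulate (λ j → does (P? j)) ⇔ P i
∈-tabulate-does⇔ {P = P} P? i = mk⇔ to′ from′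
  where
  from′ : P i → i ∈ tabulate (λ j → does (P? j))
  from′ Pi = lookup⇒[]= i _ (trans (lookup∘tabulate _ i) (dec-true (P? i) Pi))

  to′ : i ∈ tabulate (λ j → does (P? j)) → P i
  to′ i∈ with P? i | trans (sym (lookup∘tabulate _ i)) ([]=⇒lookup i∈)
  ... | yes Pi | _ = Pi
  ... | no _   | ()

∈-recolor⇔ : {m k : ℕ} (p : Fin m → Fin k) (S : Subset m) (i : Fin k) →
             i ∈ recolor p S ⇔ (∃ λ c → c ∈ S × p c ≡ i)
∈-recolor⇔ p S = ∈-tabulate-does⇔ (λ i → any? λ c → (c ∈? S) ×-dec (p c ≟ i))

∃-cong-⇔ : {m k : ℕ} {P Q : Pred (Fin m) 0ℓ} (p : Fin m → Fin k) (i : Fin k) →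
           (∀ c → P c ⇔ Q c) → (∃ λ c → P c × p c ≡ i) ⇔ (∃ λ c → Q c × p c ≡ i)
∃-cong-⇔ p i P⇔Q = mk⇔ (λ (c , Pc , pc≡i) → c , to (P⇔Q c) Pc , pc≡i)
                       (λ (c , Qc , pc≡i) → c , from (P⇔Q c) Qc , pc≡i)

PathHasColor-recolor⇔ : {n m k : ℕ} (T : PhyloTree n) (lab : Labeling T m) (p : Fin m → Fin k)
                        (u v : Fin (N T)) (i : Fin k) →
                        PathHasColor T (recolorLab {T = T} p lab) u v i
                        ⇔ (∃ λ c → PathHasColor T lab u v c × p c ≡ i)
PathHasColor-recolor⇔ T lab p u v i = mk⇔
  (λ (w , h , i∈ , w⪯v , u⪯w , u≢w) →
     let (c , c∈ , pc≡i) = to (∈-recolor⇔ p (lab w h) i) i∈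
     in c , (w , h , c∈ , w⪯v , u⪯w , u≢w) , pc≡i)
  (λ (c , (w , h , c∈ , w⪯v , u⪯w , u≢w) , pc≡i) →
     w , h , from (∈-recolor⇔ p (lab w h) i) (c , c∈ , pc≡i) , w⪯v , u⪯w , u≢w)

Explains-recolor : {n m k : ℕ} (T : PhyloTree n) (lab : Labeling T m) (ε : IrrMap n m)
                   (p : Fin m → Fin k) → Explains T lab ε →
                   Explains T (recolorLab {T = T} p lab) (recolorMap p ε)
Explains-recolor T lab ε p explains x y x≢y i u lca = to i∈ε⇔path , from i∈ε⇔path
  where
  colorwise : ∀ c → c ∈ ε x y x≢y ⇔ PathHasColor T lab u (leaf T y) c
  colorwise c = let (⇒ , ⇐) = explains x y x≢y c u lca in mk⇔ ⇒ ⇐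

  i∈ε⇔path : i ∈ recolorMap p ε x y x≢y ⇔ PathHasColor T (recolorLab {T = T} p lab) u (leaf T y) i
  i∈ε⇔path = ⇔.trans (∈-recolor⇔ p (ε x y x≢y) i)
    (⇔.trans (∃-cong-⇔ p i colorwise)
      (⇔.sym (PathHasColor-recolor⇔ T lab p u (leaf T y) i)))

corollary5 : {n m k : ℕ} → 1 ≤ n → 1 ≤ m → 1 ≤ k →
    (ε : IrrMap n m) (T : PhyloTree n) (lab : Labeling T m) → Explains T lab ε →
    (p : Fin m → Fin k) → Surjective _≡_ _≡_ p →
    IsFitch (recolorMap p ε) × Explains T (recolorLab {T = T} p lab) (recolorMap p ε)
corollary5 _ _ _ ε T lab explains p _ = (T , recolorLab {T = T} p lab , explainsP) , explainsP
  where
  explainsP : Explains T (recolorLab {T = T} p lab) (recolorMap p ε)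
  explainsP = Explains-recolor T lab ε p explains
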